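{- Let $M$ be a binary matroid on an $n$-element ground set $S$, of rank $r$. \begin{enumerate} \item If the ground set of $M$ is colored with exactly $r$ colors (i.e. $S$ is partitioned into exactly $r$ nonempty color classes), then $M$ contains either a rainbow colored circuit or a monochromatic cut. \item If the ground set of $M$ is colored with exactly $n-r$ colors, then $M$ contains either a rainbow colored cut or a monochromatic circuit. \end{enumerate}
   Context: A matroid is binary if it is representable over $GF(2)$. A cut of a matroid is an inclusionwise minimal subset of the ground set that intersects every basis. Given a coloring of the ground set, a subset is rainbow colored if no two of its elements have the same color, and monochromatic if all of its elements have the same color. -}

module Defs where

open import Data.Nat using (ℕ; zero; suc; _<_)
open import Data.Bool using (Bool; true; false; _∧_; _xor_)
open import Data.Fin using (Fin; zero; suc)
open import Data.Fin.Subset using (Subset; _∈_; _∉_; _⊆_; _∪_; ⁅_⁆; ∣_∣; ⊥)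
open import Data.Vec using ([]; _∷_)
open import Data.Product using (Σ; ∃; _×_)
open import Relation.Binary.PropositionalEquality using (_≡_; _≢_)
open import Relation.Nullary using (¬_)
open import Function using (_∘_)

record Matroid (n : ℕ) : Set₁ where
  field
    Indep     : Subset n → Set
    indep-∅   : Indep ⊥
    indep-⊆   : ∀ {X Y} → Y ⊆ X → Indep X → Indep Y
    indep-aug : ∀ {X Y} → Indep X → Indep Y → ∣ X ∣ < ∣ Y ∣ →
                ∃ λ e → e ∈ Y × e ∉ X × Indep (⁅ e ⁆ ∪ X)

open Matroid public

sumSel : ∀ {n} → (Fin n → Bool) → Subset n → Bool
sumSel {zero}  f []      = false
sumSel {suc n} f (b ∷ Y) = (b ∧ f zero) xor sumSel (f ∘ suc) Y

-- Linear independence over GF(2) of the columns A i (i ∈ X) of an m × n matrix A: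
-- the only vanishing GF(2)-linear combination (= subset sum) is the trivial one.
LinIndepGF2 : ∀ {n m} → (Fin n → Fin m → Bool) → Subset n → Set
LinIndepGF2 {n} {m} A X =
  ∀ Y → Y ⊆ X → (∀ (j : Fin m) → sumSel (λ i → A i j) Y ≡ false) → Y ≡ ⊥

IsBinary : ∀ {n} → Matroid n → Set
IsBinary {n} M = Σ ℕ λ m → Σ (Fin n → Fin m → Bool) λ A →
  ∀ X → (Indep M X → LinIndepGF2 A X) × (LinIndepGF2 A X → Indep M X)

module _ {n : ℕ} (M : Matroid n) where
  Dependent : Subset n → Set
  Dependent X = ¬ Indep M X

  Circuit : Subset n → Set
  Circuit C = Dependent C × (∀ Y → Y ⊆ C → Y ≢ C → Indep M Y)

  Basis : Subset n → Set
  Basis B = Indep M B × (∀ X → Indep M X → B ⊆ X → X ≡ B)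

  MeetsEveryBasis : Subset n → Set
  MeetsEveryBasis X = ∀ B → Basis B → ∃ λ e → e ∈ X × e ∈ B

  Cut : Subset n → Set
  Cut X = MeetsEveryBasis X × (∀ Y → Y ⊆ X → Y ≢ X → ¬ MeetsEveryBasis Y)

  HasRank : ℕ → Set
  HasRank r = ∃ λ B → Basis B × ∣ B ∣ ≡ r

-- A coloring with exactly k colors: surjection onto Fin k.
SurjectiveColoring : ∀ {n k} → (Fin n → Fin k) → Set
SurjectiveColoring {n} {k} c = ∀ (y : Fin k) → ∃ λ x → c x ≡ y

Rainbow : ∀ {n k} → (Fin n → Fin k) → Subset n → Set
Rainbow c X = ∀ {x y} → x ∈ X → y ∈ X → c x ≡ c y → x ≡ y

Monochromatic : ∀ {n k} → (Fin n → Fin k) → Subset n → Set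
Monochromatic c X = ∀ {x y} → x ∈ X → y ∈ X → c x ≡ c y

-- Fix a transversal τ of the colour classes. For part 1, if τ is dependent it contains a
-- rainbow circuit; otherwise it is a basis T, and over GF(2) we read off its fundamental
-- matrix R c x = [τ c lies in the fundamental circuit of x]. If R (col x) x = 0 for some x,
-- exchanging x for τ (col x) gives a dependent transversal. If some colour c has
-- R c x = 0 for every x ∉ T of another colour, the class of c meets every basis and so
-- contains a monochromatic cut. Otherwise every element has an in-arc in the digraph
-- x → y :⇔ R (col y) x = 1, col x ≢ col y, hence there is a chordless cycle. Its vertices
-- have distinct colours, and the GF(2)-sum of their fundamental circuits is a nonempty
-- zero-sum set inside the transversal through the cycle: each chosen element τ (col (f s))
-- on the cycle is hit exactly twice. Part 2 is the same argument for the complement of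
-- the transversal, with circuits and cuts exchanging roles.

module Submission where

open import Defs
open import Algebra.Bundles using (CommutativeRing)
open import Data.Bool using (Bool; true; false; _∧_; _xor_)
import Data.Bool.Properties as BP
open import Data.Fin using (Fin; zero; suc; _≟_; toℕ; fromℕ<)
import Data.Fin.Properties as FP
open import Data.Fin.Subset using (Subset; _∈_; _∉_; _⊆_; _∪_; ⁅_⁆; ∣_∣; ⊥; ∁; _-_; inside; outside)
import Data.Fin.Subset.Properties as SP
open import Data.Nat using (ℕ; zero; suc; _≤_; _<_; _+_; _∸_; z≤n; s≤s; _≤?_)
open import Data.Nat.Induction using (<-wellFounded)
import Data.Nat.Properties as ℕP
open import Data.Product using (Σ; ∃; _×_; _,_; proj₁; proj₂; map₂)
open import Data.Sum using (_⊎_; inj₁; inj₂)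
import Data.Sum
open import Data.Vec using ([]; _∷_; lookup; zipWith; tabulate; here; there)
import Data.Vec.Properties as VP
open import Function using (_∘_; id; case_of_)
open import Induction.WellFounded using (Acc; acc)
open import Relation.Binary.Definitions using (tri<; tri≈; tri>)
open import Relation.Binary.PropositionalEquality
open import Relation.Nullary using (¬_; Dec; yes; no; does; contradiction)
open import Relation.Nullary.Decidable using (_×-dec_; _⊎-dec_; _→-dec_; ¬?; dec-true; decidable-stable)
open import Relation.Unary using (Decidable)

open import Algebra.Properties.CommutativeSemigroup
  (CommutativeRing.+-commutativeSemigroup BP.xor-∧-commutativeRing)
  using () renaming (interchange to xor-interchange)

-- Sums over GF(2)

xor-cancelˡ : ∀ x y → x xor (x xor y) ≡ y
xor-cancelˡ x y = trans (sym (BP.xor-assoc x x y)) (cong (_xor y) (BP.xor-same x))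

xorSum : ℕ → (ℕ → Bool) → Bool
xorSum zero    g = false
xorSum (suc L) g = xorSum L g xor g L

xorSum-cong : ∀ L {g h : ℕ → Bool} → (∀ i → i < L → g i ≡ h i) → xorSum L g ≡ xorSum L h
xorSum-cong zero    g≗h = refl
xorSum-cong (suc L) g≗h =
  cong₂ _xor_ (xorSum-cong L (λ i i<L → g≗h i (ℕP.m<n⇒m<1+n i<L))) (g≗h L ℕP.≤-refl)

xorSum-xor : ∀ L (g h : ℕ → Bool) → xorSum L (λ i → g i xor h i) ≡ xorSum L g xor xorSum L h
xorSum-xor zero    g h = refl
xorSum-xor (suc L) g h =
  trans (cong (_xor (g L xor h L)) (xorSum-xor L g h)) (xor-interchange (xorSum L g) (xorSum L h) (g L) (h L))

xorSum-telescope : ∀ L (g : ℕ → Bool) → xorSum L (λ i → g i xor g (suc i)) ≡ g 0 xor g L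
xorSum-telescope zero    g = sym (BP.xor-same (g 0))
xorSum-telescope (suc L) g = begin
  xorSum L (λ i → g i xor g (suc i)) xor (g L xor g (suc L)) ≡⟨ cong (_xor (g L xor g (suc L))) (xorSum-telescope L g) ⟩
  (g 0 xor g L) xor (g L xor g (suc L))                        ≡⟨ BP.xor-assoc (g 0) (g L) _ ⟩
  g 0 xor (g L xor (g L xor g (suc L)))                        ≡⟨ cong (g 0 xor_) (xor-cancelˡ (g L) (g (suc L))) ⟩
  g 0 xor g (suc L)                                            ∎
  where open ≡-Reasoning

xorSum-allFalse : ∀ L {g : ℕ → Bool} → (∀ i → i < L → g i ≡ false) → xorSum L g ≡ false
xorSum-allFalse zero    g≡false = refl
xorSum-allFalse (suc L) g≡false =
  cong₂ _xor_ (xorSum-allFalse L (λ i i<L → g≡false i (ℕP.m<n⇒m<1+n i<L))) (g≡false L ℕP.≤-refl)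

xorSum-uniqueTrue : ∀ L {g : ℕ → Bool} {m} → m < L → g m ≡ true →
                    (∀ i → i < L → g i ≡ true → i ≡ m) → xorSum L g ≡ true
xorSum-uniqueTrue (suc L) {g} {m} m<1+L gm unique with ℕP.m≤n⇒m<n∨m≡n (ℕP.≤-pred m<1+L)
... | inj₁ m<L = cong₂ _xor_ (xorSum-uniqueTrue L m<L gm (λ i i<L → unique i (ℕP.m<n⇒m<1+n i<L)))
                             (BP.¬-not (λ gL → ℕP.<-irrefl (sym (unique L ℕP.≤-refl gL)) m<L))
... | inj₂ refl = cong₂ _xor_
  (xorSum-allFalse L λ i i<L → BP.¬-not λ gi → ℕP.<-irrefl (unique i (ℕP.m<n⇒m<1+n i<L) gi) i<L) gm

xorSum-true⇒∃ : ∀ L {g : ℕ → Bool} → xorSum L g ≡ true → ∃ λ i → i < L × g i ≡ true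
xorSum-true⇒∃ (suc L) {g} sum≡true with g L in gL
... | true  = L , ℕP.≤-refl , gL
... | false = map₂ (λ (i<L , gi) → ℕP.m<n⇒m<1+n i<L , gi)
                   (xorSum-true⇒∃ L (trans (sym (BP.xor-identityʳ _)) sum≡true))

∈⇒lookup : ∀ {n} {x : Fin n} {X} → x ∈ X → lookup X x ≡ true
∈⇒lookup = VP.[]=⇒lookup

lookup⇒∈ : ∀ {n} {x : Fin n} {X} → lookup X x ≡ true → x ∈ X
lookup⇒∈ {x = x} {X} = VP.lookup⇒[]= x X

lookup⇒∉ : ∀ {n} {x : Fin n} {X} → lookup X x ≡ false → x ∉ X
lookup⇒∉ lookup≡false x∈X = BP.not-¬ (∈⇒lookup x∈X) lookup≡false

_≟ˢ_ : ∀ {n} (X Y : Subset n) → Dec (X ≡ Y)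
_≟ˢ_ = VP.≡-dec BP._≟_

allSubset? : ∀ {n} {P : Subset n → Set} → Decidable P → Dec (∀ Y → P Y)
allSubset? P? with SP.anySubset? (¬? ∘ P?)
... | yes (Y , ¬PY) = no (λ ∀P → ¬PY (∀P Y))
... | no  ∄¬P       = yes (λ Y → decidable-stable (P? Y) (λ ¬PY → ∄¬P (Y , ¬PY)))

nonempty : ∀ {n} {Y : Subset n} → Y ≢ ⊥ → ∃ λ e → e ∈ Y
nonempty {Y = Y} Y≢⊥ = decidable-stable (SP.nonempty? Y) (Y≢⊥ ∘ SP.Empty-unique)

p⊆q∧p≢q⇒∣p∣<∣q∣ : ∀ {n} {X Y : Subset n} → Y ⊆ X → Y ≢ X → ∣ Y ∣ < ∣ X ∣
p⊆q∧p≢q⇒∣p∣<∣q∣ {X = X} {Y} Y⊆X Y≢X with FP.any? (λ x → x SP.∈? X ×-dec ¬? (x SP.∈? Y))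
... | yes (x , x∈X , x∉Y) = SP.p⊂q⇒∣p∣<∣q∣ (Y⊆X , x , x∈X , x∉Y)
... | no  ∄x = contradiction (SP.⊆-antisym Y⊆X X⊆Y) Y≢X
  where
  X⊆Y : X ⊆ Y
  X⊆Y {x} x∈X = decidable-stable (x SP.∈? Y) (λ x∉Y → ∄x (x , x∈X , x∉Y))

p⊆q∧∣q∣≤∣p∣⇒p≡q : ∀ {n} {X Y : Subset n} → Y ⊆ X → ∣ X ∣ ≤ ∣ Y ∣ → Y ≡ X
p⊆q∧∣q∣≤∣p∣⇒p≡q Y⊆X ∣X∣≤∣Y∣ =
  decidable-stable (_ ≟ˢ _) (λ Y≢X → ℕP.<⇒≱ (p⊆q∧p≢q⇒∣p∣<∣q∣ Y⊆X Y≢X) ∣X∣≤∣Y∣)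

q⊆⁅x⁆∪p∧x∉q⇒q⊆p : ∀ {n} {x : Fin n} {p Y} → Y ⊆ ⁅ x ⁆ ∪ p → x ∉ Y → Y ⊆ p
q⊆⁅x⁆∪p∧x∉q⇒q⊆p {x = x} {p} Y⊆ x∉Y y∈Y with SP.x∈p∪q⁻ ⁅ x ⁆ p (Y⊆ y∈Y)
... | inj₁ y∈⁅x⁆ = contradiction (subst (_∈ _) (SP.x∈⁅y⁆⇒x≡y x y∈⁅x⁆) y∈Y) x∉Y
... | inj₂ y∈p   = y∈p

Minimal : ∀ {n} → (Subset n → Set) → Subset n → Set
Minimal P Y = P Y × (∀ Z → Z ⊆ Y → Z ≢ Y → ¬ P Z)

minimal-⊆ : ∀ {n} {P : Subset n → Set} → Decidable P → ∀ X → P X → ∃ λ Y → Y ⊆ X × Minimal P Y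
minimal-⊆ {n} {P} P? X = go X (<-wellFounded ∣ X ∣)
  where
  go : ∀ X → Acc _<_ ∣ X ∣ → P X → ∃ λ Y → Y ⊆ X × Minimal P Y
  go X (acc smaller) PX with SP.anySubset? (λ Z → Z SP.⊆? X ×-dec ¬? (Z ≟ˢ X) ×-dec P? Z)
  ... | yes (Z , Z⊆X , Z≢X , PZ) =
    let Y , Y⊆Z , minY = go Z (smaller (p⊆q∧p≢q⇒∣p∣<∣q∣ Z⊆X Z≢X)) PZ in Y , Z⊆X ∘ Y⊆Z , minY
  ... | no ∄Z = X , id , PX , λ Z Z⊆X Z≢X PZ → ∄Z (Z , Z⊆X , Z≢X , PZ)

∣⁅x⁆∪p∣ : ∀ {n} (x : Fin n) (p : Subset n) → x ∉ p → ∣ ⁅ x ⁆ ∪ p ∣ ≡ suc ∣ p ∣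
∣⁅x⁆∪p∣ zero    (outside ∷ p) x∉p = cong (suc ∘ ∣_∣) (SP.∪-identityˡ p)
∣⁅x⁆∪p∣ zero    (inside  ∷ p) x∉p = contradiction here x∉p
∣⁅x⁆∪p∣ (suc x) (outside ∷ p) x∉p = ∣⁅x⁆∪p∣ x p (x∉p ∘ there)
∣⁅x⁆∪p∣ (suc x) (inside  ∷ p) x∉p = cong suc (∣⁅x⁆∪p∣ x p (x∉p ∘ there))

-- Zero-sum sets of a GF(2) matrix

_⊕_ : ∀ {n} → Subset n → Subset n → Subset n
X ⊕ Y = zipWith _xor_ X Y

sumSel-⊕ : ∀ {n} (f : Fin n → Bool) X Y → sumSel f (X ⊕ Y) ≡ sumSel f X xor sumSel f Y
sumSel-⊕ {zero}  f []      []      = refl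
sumSel-⊕ {suc n} f (a ∷ X) (b ∷ Y) =
  trans (cong₂ _xor_ (BP.∧-distribʳ-xor (f zero) a b) (sumSel-⊕ (f ∘ suc) X Y))
        (xor-interchange (a ∧ f zero) (b ∧ f zero) _ _)

sumSel-⊥ : ∀ {n} (f : Fin n → Bool) → sumSel f ⊥ ≡ false
sumSel-⊥ {zero}  f = refl
sumSel-⊥ {suc n} f = sumSel-⊥ (f ∘ suc)

ZeroSum : ∀ {n m} → (Fin n → Fin m → Bool) → Subset n → Set
ZeroSum {m = m} A Y = ∀ (j : Fin m) → sumSel (λ i → A i j) Y ≡ false

zeroSum? : ∀ {n m} (A : Fin n → Fin m → Bool) → Decidable (ZeroSum A)
zeroSum? A Y = FP.all? (λ j → sumSel (λ i → A i j) Y BP.≟ false)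

zeroSum-⊕ : ∀ {n m} (A : Fin n → Fin m → Bool) {X Y} → ZeroSum A X → ZeroSum A Y → ZeroSum A (X ⊕ Y)
zeroSum-⊕ A {X} {Y} ΣX ΣY j = trans (sumSel-⊕ (λ i → A i j) X Y) (cong₂ _xor_ (ΣX j) (ΣY j))

⨁ : ∀ {n} → ℕ → (ℕ → Subset n) → Subset n
⨁ zero    Xs = ⊥
⨁ (suc L) Xs = ⨁ L Xs ⊕ Xs L

lookup-⨁ : ∀ {n} L (Xs : ℕ → Subset n) e → lookup (⨁ L Xs) e ≡ xorSum L (λ s → lookup (Xs s) e)
lookup-⨁ zero    Xs e = VP.lookup-replicate e false
lookup-⨁ (suc L) Xs e =
  trans (VP.lookup-zipWith _xor_ e (⨁ L Xs) (Xs L)) (cong (_xor lookup (Xs L) e) (lookup-⨁ L Xs e))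

zeroSum-⨁ : ∀ {n m} (A : Fin n → Fin m → Bool) L Xs → (∀ s → s < L → ZeroSum A (Xs s)) → ZeroSum A (⨁ L Xs)
zeroSum-⨁ A zero    Xs ΣXs j = sumSel-⊥ (λ i → A i j)
zeroSum-⨁ A (suc L) Xs ΣXs =
  zeroSum-⊕ A (zeroSum-⨁ A L Xs (λ s s<L → ΣXs s (ℕP.m<n⇒m<1+n s<L))) (ΣXs L ℕP.≤-refl)

-- Matroids

module MatroidProperties {n} (M : Matroid n) where

  basis-insert-dependent : ∀ {B e} → Basis M B → e ∉ B → ¬ Indep M (⁅ e ⁆ ∪ B)
  basis-insert-dependent {B} {e} (_ , maximal) e∉B indep =
    e∉B (subst (e ∈_) (maximal _ indep (SP.q⊆p∪q ⁅ e ⁆ B)) (SP.p⊆p∪q B (SP.x∈⁅x⁆ e)))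

  indep-card≤basis-card : ∀ {B X} → Basis M B → Indep M X → ∣ X ∣ ≤ ∣ B ∣
  indep-card≤basis-card {B} {X} basis indep with ℕP.≤-<-connex ∣ X ∣ ∣ B ∣
  ... | inj₁ ∣X∣≤∣B∣ = ∣X∣≤∣B∣
  ... | inj₂ ∣B∣<∣X∣ =
    let e , _ , e∉B , indep′ = indep-aug M (proj₁ basis) indep ∣B∣<∣X∣
    in contradiction indep′ (basis-insert-dependent basis e∉B)

  basis-card : ∀ {B B′} → Basis M B → Basis M B′ → ∣ B′ ∣ ≡ ∣ B ∣
  basis-card basis basis′ =
    ℕP.≤-antisym (indep-card≤basis-card basis (proj₁ basis′)) (indep-card≤basis-card basis′ (proj₁ basis))

  full-card-insert-dependent : ∀ {B₀ I x} → Basis M B₀ → ∣ I ∣ ≡ ∣ B₀ ∣ → x ∉ I → ¬ Indep M (⁅ x ⁆ ∪ I)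
  full-card-insert-dependent {I = I} {x} basis₀ ∣I∣≡r x∉I indep =
    ℕP.<⇒≱ (ℕP.≤-reflexive (cong suc (sym ∣I∣≡r)))
      (subst (_≤ _) (∣⁅x⁆∪p∣ x I x∉I) (indep-card≤basis-card basis₀ indep))

  -- A basis avoiding X lies in ∁ X, so it would have to be all of ∁ X.
  ∁-dependent⇒meetsEveryBasis : ∀ {B₀ X} → Basis M B₀ → ∣ ∁ X ∣ ≤ ∣ B₀ ∣ → ¬ Indep M (∁ X) →
                                MeetsEveryBasis M X
  ∁-dependent⇒meetsEveryBasis {B₀} {X} basis₀ ∣∁X∣≤r ∁X-dependent B basis =
    decidable-stable (FP.any? (λ e → e SP.∈? X ×-dec e SP.∈? B)) λ disjoint →
      let B⊆∁X : B ⊆ ∁ X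
          B⊆∁X e∈B = SP.x∉p⇒x∈∁p (λ e∈X → disjoint (_ , e∈X , e∈B))
          B≡∁X = p⊆q∧∣q∣≤∣p∣⇒p≡q B⊆∁X (ℕP.≤-trans ∣∁X∣≤r (ℕP.≤-reflexive (sym (basis-card basis₀ basis))))
      in ∁X-dependent (subst (Indep M) B≡∁X (proj₁ basis))

  module WithDecidableIndep (indep? : Decidable (Indep M)) where

    basis? : Decidable (Basis M)
    basis? B = indep? B ×-dec allSubset? (λ X → indep? X →-dec (B SP.⊆? X →-dec X ≟ˢ B))

    meetsEveryBasis? : Decidable (MeetsEveryBasis M)
    meetsEveryBasis? X = allSubset? (λ B → basis? B →-dec FP.any? (λ e → e SP.∈? X ×-dec e SP.∈? B))

    circuit-⊆ : ∀ X → ¬ Indep M X → ∃ λ C → C ⊆ X × Circuit M C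
    circuit-⊆ X dependent =
      let C , C⊆X , dependentC , minimal = minimal-⊆ (¬? ∘ indep?) X dependent
      in C , C⊆X , dependentC , λ Y Y⊆C Y≢C → decidable-stable (indep? Y) (minimal Y Y⊆C Y≢C)

    cut-⊆ : ∀ X → MeetsEveryBasis M X → ∃ λ D → D ⊆ X × Cut M D
    cut-⊆ = minimal-⊆ meetsEveryBasis?

Represents : ∀ {n m} → Matroid n → (Fin n → Fin m → Bool) → Set
Represents M A = ∀ X → (Indep M X → LinIndepGF2 A X) × (LinIndepGF2 A X → Indep M X)

module BinaryMatroid {n m} (M : Matroid n) (A : Fin n → Fin m → Bool) (rep : Represents M A) where

  open MatroidProperties M public

  linIndep? : Decidable (LinIndepGF2 A)
  linIndep? X = allSubset? (λ Y → Y SP.⊆? X →-dec (zeroSum? A Y →-dec Y ≟ˢ ⊥))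

  indep? : Decidable (Indep M)
  indep? X with linIndep? X
  ... | yes li = yes (proj₂ (rep X) li)
  ... | no ¬li = no (¬li ∘ proj₁ (rep X))

  open WithDecidableIndep indep? public

  zeroSum⇒dependent : ∀ {X Y e} → Y ⊆ X → ZeroSum A Y → e ∈ Y → ¬ Indep M X
  zeroSum⇒dependent {X} {Y} {e} Y⊆X ΣY e∈Y indep =
    SP.∉⊥ (subst (e ∈_) (proj₁ (rep X) indep Y Y⊆X ΣY) e∈Y)

  dependent⇒zeroSum : ∀ {X} → ¬ Indep M X → ∃ λ Y → Y ⊆ X × ZeroSum A Y × Y ≢ ⊥
  dependent⇒zeroSum {X} dependent =
    decidable-stable (SP.anySubset? (λ Y → Y SP.⊆? X ×-dec zeroSum? A Y ×-dec ¬? (Y ≟ˢ ⊥))) λ ∄Y →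
      dependent (proj₂ (rep X) λ Y Y⊆X ΣY → decidable-stable (Y ≟ˢ ⊥) (λ Y≢⊥ → ∄Y (Y , Y⊆X , ΣY , Y≢⊥)))

  -- K x is the fundamental circuit of x ∉ I with respect to I; the junk value ⊥ is taken for x ∈ I.
  module FundamentalCircuits {I} (indep : Indep M I) (saturated : ∀ {x} → x ∉ I → ¬ Indep M (⁅ x ⁆ ∪ I)) where

    fundamental : ∀ x → ∃ λ Y → Y ⊆ ⁅ x ⁆ ∪ I × ZeroSum A Y × (x ∉ I → x ∈ Y)
    fundamental x with x SP.∈? I
    ... | yes x∈I =
      ⊥ , (λ z∈⊥ → contradiction z∈⊥ SP.∉⊥) , (λ j → sumSel-⊥ (λ i → A i j)) , (λ x∉I → contradiction x∈I x∉I)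
    ... | no  x∉I =
      let Y , Y⊆ , ΣY , Y≢⊥ = dependent⇒zeroSum (saturated x∉I)
      in Y , Y⊆ , ΣY , λ _ → decidable-stable (x SP.∈? Y) λ x∉Y →
           zeroSum⇒dependent (q⊆⁅x⁆∪p∧x∉q⇒q⊆p Y⊆ x∉Y) ΣY (proj₂ (nonempty Y≢⊥)) indep

    K : Fin n → Subset n
    K x = proj₁ (fundamental x)

    K-⊆ : ∀ {x z} → z ∈ K x → z ≡ x ⊎ z ∈ I
    K-⊆ {x} z∈K = Data.Sum.map₁ (SP.x∈⁅y⁆⇒x≡y x) (SP.x∈p∪q⁻ ⁅ x ⁆ I (proj₁ (proj₂ (fundamental x)) z∈K))

    K-zeroSum : ∀ x → ZeroSum A (K x)
    K-zeroSum x = proj₁ (proj₂ (proj₂ (fundamental x)))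

    K-∋ : ∀ {x} → x ∉ I → x ∈ K x
    K-∋ {x} = proj₂ (proj₂ (proj₂ (fundamental x)))

-- Chordless closed walks

module ClosedWalks {n} (Edge : Fin n → Fin n → Set) (Good : Fin n → Set) where

  record ClosedWalk : Set where
    field
      L      : ℕ
      f      : ℕ → Fin n
      L≥1    : 1 ≤ L
      closed : f L ≡ f 0
      edge   : ∀ t → t < L → Edge (f t) (f (suc t))
      good   : ∀ t → t < L → Good (f t)

  open ClosedWalk

  Next : ℕ → ℕ → ℕ → Set
  Next L i j = j ≡ suc i ⊎ (suc i ≡ L × j ≡ 0)

  next? : ∀ L i j → Dec (Next L i j)
  next? L i j = (j ℕP.≟ suc i) ⊎-dec ((suc i ℕP.≟ L) ×-dec (j ℕP.≟ 0))

  Chord : ClosedWalk → ℕ → ℕ → Set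
  Chord w i j = i < L w × j < L w × Edge (f w i) (f w j) × ¬ Next (L w) i j

  Chordless : ClosedWalk → Set
  Chordless w = ∀ i j → i < L w → j < L w → Edge (f w i) (f w j) → Next (L w) i j

  -- The chord closes the cycle f j → … → f i → f j.
  shortcut-backward : ∀ w {i j} → Chord w i j → j ≤ i → Σ ClosedWalk λ w′ → L w′ < L w
  shortcut-backward w {i} {j} (i<L , j<L , chord , ¬next) j≤i =
    record { L = suc d ; f = g ; L≥1 = s≤s z≤n ; closed = g-closed ; edge = g-edge ; good = g-good } , shorter j refl
    where
    d = i ∸ j
    j+d≡i : j + d ≡ i
    j+d≡i = ℕP.m+[n∸m]≡n j≤i
    g : ℕ → Fin n
    g t with t ≤? d
    ... | yes _ = f w (j + t)
    ... | no  _ = f w j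
    g-≤ : ∀ {t} → t ≤ d → g t ≡ f w (j + t)
    g-≤ {t} t≤d with t ≤? d
    ... | yes _   = refl
    ... | no  t≰d = contradiction t≤d t≰d
    g-end : g (suc d) ≡ f w j
    g-end with suc d ≤? d
    ... | yes 1+d≤d = contradiction 1+d≤d ℕP.1+n≰n
    ... | no  _     = refl
    g-closed : g (suc d) ≡ g 0
    g-closed = trans g-end (sym (trans (g-≤ z≤n) (cong (f w) (ℕP.+-identityʳ j))))
    j+t<L : ∀ {t} → t ≤ d → j + t < L w
    j+t<L t≤d = ℕP.≤-<-trans (subst (j + _ ≤_) j+d≡i (ℕP.+-monoʳ-≤ j t≤d)) i<L
    g-edge : ∀ t → t < suc d → Edge (g t) (g (suc t))
    g-edge t t<1+d with ℕP.m≤n⇒m<n∨m≡n (ℕP.≤-pred t<1+d)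
    ... | inj₁ t<d  = subst₂ Edge (sym (g-≤ (ℕP.<⇒≤ t<d))) (sym (trans (g-≤ t<d) (cong (f w) (ℕP.+-suc j t))))
                               (edge w (j + t) (j+t<L (ℕP.<⇒≤ t<d)))
    ... | inj₂ refl = subst₂ Edge (sym (trans (g-≤ ℕP.≤-refl) (cong (f w) j+d≡i))) (sym g-end) chord
    g-good : ∀ t → t < suc d → Good (g t)
    g-good t t<1+d = subst Good (sym (g-≤ (ℕP.≤-pred t<1+d))) (good w (j + t) (j+t<L (ℕP.≤-pred t<1+d)))
    shorter : ∀ j′ → j′ ≡ j → suc d < L w
    shorter zero    refl = ℕP.≤∧≢⇒< i<L (λ 1+i≡L → ¬next (inj₂ (1+i≡L , refl)))
    shorter (suc _) refl = ℕP.≤-<-trans (ℕP.∸-monoʳ-< {i} {j} {0} (s≤s z≤n) j≤i) i<L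

  -- The chord skips the stretch f (suc i) … f (j ∸ 1) of the walk.
  shortcut-forward : ∀ w {i j} → Chord w i j → i < j → Σ ClosedWalk λ w′ → L w′ < L w
  shortcut-forward w {i} {j} (i<L , j<L , chord , ¬next) i<j =
    record { L = L′ ; f = g ; L≥1 = ℕP.≤-<-trans z≤n i<L′ ; closed = g-closed ; edge = g-edge ; good = g-good } , L′<L
    where
    d = j ∸ suc i
    1+i+d≡j : suc i + d ≡ j
    1+i+d≡j = ℕP.m+[n∸m]≡n i<j
    d≥1 : 1 ≤ d
    d≥1 = ℕP.m<n⇒0<n∸m (ℕP.≤∧≢⇒< i<j (λ 1+i≡j → ¬next (inj₁ (sym 1+i≡j))))
    d≤L : d ≤ L w
    d≤L = ℕP.≤-trans (ℕP.m∸n≤m j (suc i)) (ℕP.<⇒≤ j<L)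
    L′ = L w ∸ d
    L′+d≡L : L′ + d ≡ L w
    L′+d≡L = ℕP.m∸n+n≡m d≤L
    i<L′ : i < L′
    i<L′ = ℕP.m+n≤o⇒m≤o∸n (suc i) (subst (_≤ L w) (sym 1+i+d≡j) (ℕP.<⇒≤ j<L))
    L′<L : L′ < L w
    L′<L = ℕP.∸-monoʳ-< {L w} {d} {0} d≥1 d≤L
    t+d<L : ∀ {t} → t < L′ → t + d < L w
    t+d<L {t} t<L′ = subst (t + d <_) L′+d≡L (ℕP.+-monoˡ-< d t<L′)
    g : ℕ → Fin n
    g t with t ≤? i
    ... | yes _ = f w t
    ... | no  _ = f w (t + d)
    g-≤ : ∀ {t} → t ≤ i → g t ≡ f w t
    g-≤ {t} t≤i with t ≤? i
    ... | yes _   = refl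
    ... | no  t≰i = contradiction t≤i t≰i
    g-> : ∀ {t} → i < t → g t ≡ f w (t + d)
    g-> {t} i<t with t ≤? i
    ... | yes t≤i = contradiction t≤i (ℕP.<⇒≱ i<t)
    ... | no  _   = refl
    g-closed : g L′ ≡ g 0
    g-closed = trans (g-> i<L′) (trans (cong (f w) L′+d≡L) (trans (closed w) (sym (g-≤ z≤n))))
    g-edge : ∀ t → t < L′ → Edge (g t) (g (suc t))
    g-edge t t<L′ with ℕP.<-cmp t i
    ... | tri< t<i _ _ = subst₂ Edge (sym (g-≤ (ℕP.<⇒≤ t<i))) (sym (g-≤ t<i)) (edge w t (ℕP.<-trans t<i i<L))
    ... | tri≈ _ refl _ = subst₂ Edge (sym (g-≤ ℕP.≤-refl)) (sym (trans (g-> ℕP.≤-refl) (cong (f w) 1+i+d≡j))) chord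
    ... | tri> _ _ i<t = subst₂ Edge (sym (g-> i<t)) (sym (g-> (ℕP.m<n⇒m<1+n i<t))) (edge w (t + d) (t+d<L t<L′))
    g-good : ∀ t → t < L′ → Good (g t)
    g-good t t<L′ with t ≤? i
    ... | yes t≤i = good w t (ℕP.≤-<-trans t≤i i<L)
    ... | no  _   = good w (t + d) (t+d<L t<L′)

  ∸-suc : ∀ {b t} → t < b → b ∸ t ≡ suc (b ∸ suc t)
  ∸-suc {suc b} {zero}  _         = refl
  ∸-suc {suc b} {suc t} (s≤s t<b) = ∸-suc t<b

  iterate : (Fin n → Fin n) → Fin n → ℕ → Fin n
  iterate pred x₀ zero    = x₀
  iterate pred x₀ (suc t) = pred (iterate pred x₀ t)

  -- Walking backwards along predecessors from x₀ must repeat a vertex within n steps.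
  closedWalk-of-predecessors : (pred : Fin n → Fin n) → (∀ y → Good (pred y)) → (∀ y → Edge (pred y) y) →
                               Fin n → ClosedWalk
  closedWalk-of-predecessors pred pred-good pred-edge x₀
    with a , b , a<b , h[a]≡h[b] ← FP.pigeonhole (ℕP.n<1+n n) (iterate pred x₀ ∘ toℕ) =
    record { L = toℕ b ∸ toℕ a ; f = λ t → h (toℕ b ∸ t) ; L≥1 = ℕP.m<n⇒0<n∸m a<b
           ; closed = trans (cong h (ℕP.m∸[m∸n]≡n (ℕP.<⇒≤ a<b))) h[a]≡h[b]
           ; edge = λ t t<L → subst (λ s → Edge (h s) (h (toℕ b ∸ suc t))) (sym (∸-suc (t<b t<L))) (pred-edge _)
           ; good = λ t t<L → subst (Good ∘ h) (sym (∸-suc (t<b t<L))) (pred-good _) }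
    where
    h = iterate pred x₀
    t<b : ∀ {t} → t < toℕ b ∸ toℕ a → t < toℕ b
    t<b t<L = ℕP.<-≤-trans t<L (ℕP.m∸n≤m (toℕ b) (toℕ a))

  module _ (edge? : ∀ x y → Dec (Edge x y)) where

    shortcut : ∀ w {i j} → Chord w i j → Σ ClosedWalk λ w′ → L w′ < L w
    shortcut w {i} {j} chord with ℕP.≤-<-connex j i
    ... | inj₁ j≤i = shortcut-backward w chord j≤i
    ... | inj₂ i<j = shortcut-forward w chord i<j

    -- A shortest closed walk is chordless.
    chordless : ClosedWalk → Σ ClosedWalk Chordless
    chordless w = go w (<-wellFounded (L w))
      where
      go : ∀ w → Acc _<_ (L w) → Σ ClosedWalk Chordless
      go w (acc shorter)
        with ℕP.anyUpTo? (λ i → ℕP.anyUpTo? (λ j → edge? (f w i) (f w j) ×-dec ¬? (next? (L w) i j)) (L w)) (L w)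
      ... | yes (i , i<L , j , j<L , e , ¬next) = let w′ , w′<w = shortcut w (i<L , j<L , e , ¬next) in go w′ (shorter w′<w)
      ... | no ∄chord = w , λ i j i<L j<L e →
        decidable-stable (next? (L w) i j) (λ ¬next → ∄chord (i , i<L , j , j<L , e , ¬next))

-- Colourings and transversals

image : ∀ {n k} → (Fin k → Fin n) → Subset n
image {k = zero}  ρ = ⊥
image {k = suc k} ρ = ⁅ ρ zero ⁆ ∪ image (ρ ∘ suc)

∈-image : ∀ {n k} (ρ : Fin k → Fin n) c → ρ c ∈ image ρ
∈-image ρ zero    = SP.p⊆p∪q (image (ρ ∘ suc)) (SP.x∈⁅x⁆ (ρ zero))
∈-image ρ (suc c) = SP.q⊆p∪q ⁅ ρ zero ⁆ (image (ρ ∘ suc)) (∈-image (ρ ∘ suc) c)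

∈-image⁻ : ∀ {n k} (ρ : Fin k → Fin n) {e} → e ∈ image ρ → ∃ λ c → ρ c ≡ e
∈-image⁻ {k = zero}  ρ e∈ = contradiction e∈ SP.∉⊥
∈-image⁻ {k = suc k} ρ e∈ with SP.x∈p∪q⁻ ⁅ ρ zero ⁆ (image (ρ ∘ suc)) e∈
... | inj₁ e∈⁅ρ0⁆ = zero , sym (SP.x∈⁅y⁆⇒x≡y _ e∈⁅ρ0⁆)
... | inj₂ e∈rest = let c , ρ[1+c]≡e = ∈-image⁻ (ρ ∘ suc) e∈rest in suc c , ρ[1+c]≡e

∣image∣ : ∀ {n k} (ρ : Fin k → Fin n) → (∀ {a b} → ρ a ≡ ρ b → a ≡ b) → ∣ image ρ ∣ ≡ k
∣image∣ {n} {zero}  ρ injective = SP.∣⊥∣≡0 n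
∣image∣ {k = suc k} ρ injective =
  trans (∣⁅x⁆∪p∣ (ρ zero) (image (ρ ∘ suc)) ρ0∉rest)
        (cong suc (∣image∣ (ρ ∘ suc) (FP.suc-injective ∘ injective)))
  where
  ρ0∉rest : ρ zero ∉ image (ρ ∘ suc)
  ρ0∉rest ρ0∈ with c , ρ[1+c]≡ρ0 ← ∈-image⁻ (ρ ∘ suc) ρ0∈ with () ← injective ρ[1+c]≡ρ0

rainbow-⊆ : ∀ {n k} {c : Fin n → Fin k} {X Y} → Y ⊆ X → Rainbow c X → Rainbow c Y
rainbow-⊆ Y⊆X rainbow x∈ y∈ = rainbow (Y⊆X x∈) (Y⊆X y∈)

monochromatic-⊆ : ∀ {n k} {c : Fin n → Fin k} {X Y} → Y ⊆ X → Monochromatic c X → Monochromatic c Y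
monochromatic-⊆ Y⊆X mono x∈ y∈ = mono (Y⊆X x∈) (Y⊆X y∈)

module Colouring {n k} (col : Fin n → Fin k) (surjective : SurjectiveColoring col) where

  IsTransversal : (Fin k → Fin n) → Set
  IsTransversal ρ = ∀ c → col (ρ c) ≡ c

  τ : Fin k → Fin n
  τ c = proj₁ (surjective c)

  τ-transversal : IsTransversal τ
  τ-transversal c = proj₂ (surjective c)

  module _ {ρ} (transversal : IsTransversal ρ) where

    transversal-injective : ∀ {a b} → ρ a ≡ ρ b → a ≡ b
    transversal-injective {a} {b} ρa≡ρb = trans (sym (transversal a)) (trans (cong col ρa≡ρb) (transversal b))

    ∣transversal∣ : ∣ image ρ ∣ ≡ k
    ∣transversal∣ = ∣image∣ ρ transversal-injective

    ∈transversal⁻ : ∀ {e} → e ∈ image ρ → ρ (col e) ≡ e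
    ∈transversal⁻ e∈ with c , refl ← ∈-image⁻ ρ e∈ = cong ρ (transversal c)

    ∉transversal : ∀ {e} → ρ (col e) ≢ e → e ∈ ∁ (image ρ)
    ∉transversal ρ[col-e]≢e = SP.x∉p⇒x∈∁p (ρ[col-e]≢e ∘ ∈transversal⁻)

    rainbow-transversal : Rainbow col (image ρ)
    rainbow-transversal x∈ y∈ cx≡cy = trans (sym (∈transversal⁻ x∈)) (trans (cong ρ cx≡cy) (∈transversal⁻ y∈))

  ∈transversal : ∀ ρ {e} → ρ (col e) ≡ e → e ∈ image ρ
  ∈transversal ρ {e} ρ[col-e]≡e = subst (_∈ image ρ) ρ[col-e]≡e (∈-image ρ (col e))

  colourClass : Fin k → Subset n
  colourClass c = tabulate (λ e → does (col e ≟ c))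

  ∈colourClass⁻ : ∀ {c e} → e ∈ colourClass c → col e ≡ c
  ∈colourClass⁻ {c} {e} e∈
    with col e ≟ c | trans (sym (VP.lookup∘tabulate (λ e → does (col e ≟ c)) e)) (∈⇒lookup e∈)
  ... | yes ce≡c | _ = ce≡c

  ∈colourClass⁺ : ∀ {c e} → col e ≡ c → e ∈ colourClass c
  ∈colourClass⁺ {c} {e} ce≡c =
    lookup⇒∈ (trans (VP.lookup∘tabulate (λ e → does (col e ≟ c)) e) (dec-true (col e ≟ c) ce≡c))

  monochromatic-colourClass : ∀ c → Monochromatic col (colourClass c)
  monochromatic-colourClass c x∈ y∈ = trans (∈colourClass⁻ x∈) (sym (∈colourClass⁻ y∈))

  Unchosen : Fin n → Set
  Unchosen x = τ (col x) ≢ x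

  unchosen? : Decidable Unchosen
  unchosen? x = ¬? (τ (col x) ≟ x)

  τ-chosen : ∀ c → ¬ Unchosen (τ c)
  τ-chosen c unchosen = unchosen (cong τ (τ-transversal c))

  unchosen⇒∉ : ∀ {x} → Unchosen x → x ∉ image τ
  unchosen⇒∉ unchosen x∈ = unchosen (∈transversal⁻ τ-transversal x∈)

  ∉⇒unchosen : ∀ {x} → x ∉ image τ → Unchosen x
  ∉⇒unchosen x∉ = x∉ ∘ ∈transversal τ

  swapIn : Fin n → (Fin k → Fin n) → Fin k → Fin n
  swapIn x ρ c with c ≟ col x
  ... | yes _ = x
  ... | no  _ = ρ c

  swapIn-here : ∀ x ρ → swapIn x ρ (col x) ≡ x
  swapIn-here x ρ with col x ≟ col x
  ... | yes _  = refl
  ... | no  ≢  = contradiction refl ≢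

  swapIn-there : ∀ x ρ {c} → c ≢ col x → swapIn x ρ c ≡ ρ c
  swapIn-there x ρ {c} c≢ with c ≟ col x
  ... | yes c≡ = contradiction c≡ c≢
  ... | no  _  = refl

  swapIn-fixed : ∀ x ρ {z} → swapIn x ρ (col z) ≡ z → z ≡ x ⊎ (col z ≢ col x × ρ (col z) ≡ z)
  swapIn-fixed x ρ {z} fixed with col z ≟ col x
  ... | yes _     = inj₁ (sym fixed)
  ... | no  cz≢cx = inj₂ (cz≢cx , fixed)

  swapIn-transversal : ∀ x {ρ} → IsTransversal ρ → IsTransversal (swapIn x ρ)
  swapIn-transversal x transversal c with c ≟ col x
  ... | yes c≡ = sym c≡
  ... | no  _  = transversal c

  module FundamentalMatrix (R : Fin k → Fin n → Bool) where

    Edge : Fin n → Fin n → Set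
    Edge x y = R (col y) x ≡ true × col x ≢ col y

    edge? : ∀ x y → Dec (Edge x y)
    edge? x y = (R (col y) x BP.≟ true) ×-dec ¬? (col x ≟ col y)

    Source : Fin k → Set
    Source c = ∀ w → Unchosen w → col w ≢ c → R c w ≡ false

    source? : Decidable Source
    source? c = FP.all? (λ w → unchosen? w →-dec (¬? (col w ≟ c) →-dec (R c w BP.≟ false)))

    DiagonalOnes : Set
    DiagonalOnes = ∀ x → Unchosen x → R (col x) x ≡ true

    open ClosedWalks Edge Unchosen public

    -- Without a source, each colour c has an unchosen w with an edge into every vertex of colour c.
    trichotomy : Fin n → (∃ λ x → Unchosen x × R (col x) x ≡ false)
                       ⊎ (∃ Source)
                       ⊎ (DiagonalOnes × Σ ClosedWalk Chordless)
    trichotomy x₀ with FP.any? (λ x → unchosen? x ×-dec (R (col x) x BP.≟ false))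
    ... | yes zero-on-diagonal = inj₁ zero-on-diagonal
    ... | no  ∄zero with FP.any? source?
    ...   | yes source = inj₂ (inj₁ source)
    ...   | no  ∄source =
      inj₂ (inj₂ (diagonal , chordless edge? (closedWalk-of-predecessors (pred ∘ col) (pred-unchosen ∘ col) pred-edge x₀)))
      where
      diagonal : DiagonalOnes
      diagonal x unchosen = BP.¬-not (λ Rxx≡false → ∄zero (x , unchosen , Rxx≡false))
      into : ∀ c → ∃ λ w → Unchosen w × col w ≢ c × R c w ≡ true
      into c = decidable-stable (FP.any? (λ w → unchosen? w ×-dec ¬? (col w ≟ c) ×-dec (R c w BP.≟ true))) λ ∄w →
        ∄source (c , λ w unchosen c≢ → BP.¬-not (λ Rcw≡true → ∄w (w , unchosen , c≢ , Rcw≡true)))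
      pred : Fin k → Fin n
      pred c = proj₁ (into c)
      pred-unchosen : ∀ c → Unchosen (pred c)
      pred-unchosen c = proj₁ (proj₂ (into c))
      pred-edge : ∀ y → Edge (pred (col y)) y
      pred-edge y = let _ , _ , c≢ , R≡true = into (col y) in R≡true , c≢

    module ChordlessCycle (diagonal : DiagonalOnes) (w : ClosedWalk) (chordless : Chordless w) where
      open ClosedWalk w

      successor-on-cycle : ∀ {i} → i < L → ∃ λ j → j < L × f (suc i) ≡ f j
      successor-on-cycle {i} i<L with ℕP.m≤n⇒m<n∨m≡n i<L
      ... | inj₁ 1+i<L = suc i , 1+i<L , refl
      ... | inj₂ 1+i≡L = 0 , L≥1 , trans (cong f 1+i≡L) closed

      edge-recoloured : ∀ {x y z} → col y ≡ col z → Edge x y → Edge x z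
      edge-recoloured cy≡cz (R≡true , cx≢cy) =
        subst (λ c → R c _ ≡ true) cy≡cz R≡true , λ cx≡cz → cx≢cy (trans cx≡cz (sym cy≡cz))

      -- An earlier vertex of the colour of f (suc b) would be the target of a chord from f b.
      colour-later-distinct : ∀ {a b} → a < b → b < L → col (f a) ≢ col (f b)
      colour-later-distinct {a} {suc b} a<1+b 1+b<L ca≡c[1+b]
        with chordless b a (ℕP.<⇒≤ 1+b<L) (ℕP.<-trans a<1+b 1+b<L)
               (edge-recoloured (sym ca≡c[1+b]) (edge b (ℕP.<⇒≤ 1+b<L)))
      ... | inj₁ a≡1+b       = ℕP.<-irrefl a≡1+b a<1+b
      ... | inj₂ (1+b≡L , _) = ℕP.<-irrefl 1+b≡L 1+b<L

      colour-injective : ∀ {a b} → a < L → b < L → col (f a) ≡ col (f b) → a ≡ b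
      colour-injective {a} {b} a<L b<L ca≡cb with ℕP.<-cmp a b
      ... | tri< a<b _ _ = contradiction ca≡cb (colour-later-distinct a<b b<L)
      ... | tri≈ _ a≡b _ = a≡b
      ... | tri> _ _ b<a = contradiction (sym ca≡cb) (colour-later-distinct b<a a<L)

      next-colour : ∀ {i s} → Next L i s → col (f (suc i)) ≡ col (f s)
      next-colour (inj₁ refl)             = refl
      next-colour (inj₂ (1+i≡L , refl)) = cong col (trans (cong f 1+i≡L) closed)

      -- The row of colour col (f s) meets the cycle exactly in f s and its predecessor on the cycle.
      entry : ∀ {s i} → s < L → i < L →
              R (col (f s)) (f i) ≡ does (col (f i) ≟ col (f s)) xor does (col (f (suc i)) ≟ col (f s))
      entry {s} {i} s<L i<L with col (f i) ≟ col (f s) | col (f (suc i)) ≟ col (f s)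
      ... | yes ci≡cs | yes c[1+i]≡cs = contradiction (trans ci≡cs (sym c[1+i]≡cs)) (proj₂ (edge i i<L))
      ... | yes ci≡cs | no  _         = subst (λ c → R c (f i) ≡ true) ci≡cs (diagonal (f i) (good i i<L))
      ... | no  _     | yes c[1+i]≡cs = subst (λ c → R c (f i) ≡ true) c[1+i]≡cs (proj₁ (edge i i<L))
      ... | no  ci≢cs | no  c[1+i]≢cs =
        BP.¬-not λ R≡true → c[1+i]≢cs (next-colour (chordless i s i<L s<L (R≡true , ci≢cs)))

      row-parity : ∀ {s} → s < L → xorSum L (λ i → R (col (f s)) (f i)) ≡ false
      row-parity {s} s<L = begin
        xorSum L (λ i → R (col (f s)) (f i)) ≡⟨ xorSum-cong L (λ i i<L → entry s<L i<L) ⟩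
        xorSum L (λ i → g i xor g (suc i))   ≡⟨ xorSum-telescope L g ⟩
        g 0 xor g L                           ≡⟨ cong (λ x → g 0 xor does (col x ≟ col (f s))) closed ⟩
        g 0 xor g 0                           ≡⟨ BP.xor-same (g 0) ⟩
        false                                 ∎
        where
        open ≡-Reasoning
        g : ℕ → Bool
        g i = does (col (f i) ≟ col (f s))

      colour-count : ∀ {s₀} → s₀ < L → xorSum L (λ s → does (col (f s₀) ≟ col (f s))) ≡ true
      colour-count {s₀} s₀<L = xorSum-uniqueTrue L s₀<L (dec-true (col (f s₀) ≟ col (f s₀)) refl) unique
        where
        unique : ∀ s → s < L → does (col (f s₀) ≟ col (f s)) ≡ true → s ≡ s₀
        unique s s<L same with col (f s₀) ≟ col (f s)
        ... | yes cs₀≡cs = colour-injective s<L s₀<L (sym cs₀≡cs)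
        ... | no  _      = contradiction same λ ()

      column-parity : ∀ {i} → i < L → xorSum L (λ s → R (col (f s)) (f i)) ≡ false
      column-parity {i} i<L with j , j<L , f[1+i]≡fj ← successor-on-cycle i<L = begin
        xorSum L (λ s → R (col (f s)) (f i))
          ≡⟨ xorSum-cong L (λ s s<L → entry s<L i<L) ⟩
        xorSum L (λ s → count (f i) s xor count (f (suc i)) s)
          ≡⟨ xorSum-xor L (count (f i)) (count (f (suc i))) ⟩
        xorSum L (count (f i)) xor xorSum L (count (f (suc i)))
          ≡⟨ cong₂ _xor_ (colour-count i<L) (trans (cong (xorSum L ∘ count) f[1+i]≡fj) (colour-count j<L)) ⟩
        false
          ∎
        where
        open ≡-Reasoning
        count : Fin n → ℕ → Bool
        count x s = does (col x ≟ col (f s))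

      cycleTransversal : Fin k → Fin n
      cycleTransversal c with ℕP.anyUpTo? (λ s → col (f s) ≟ c) L
      ... | yes (s , _ , _) = f s
      ... | no  _           = τ c

      cycleTransversal-cases : ∀ c → (∃ λ s → s < L × col (f s) ≡ c × cycleTransversal c ≡ f s)
                                   ⊎ ((∀ s → s < L → col (f s) ≢ c) × cycleTransversal c ≡ τ c)
      cycleTransversal-cases c with ℕP.anyUpTo? (λ s → col (f s) ≟ c) L
      ... | yes (s , s<L , cs≡c) = inj₁ (s , s<L , cs≡c , refl)
      ... | no  ∄s               = inj₂ ((λ s s<L cs≡c → ∄s (s , s<L , cs≡c)) , refl)

      cycleTransversal-transversal : IsTransversal cycleTransversal
      cycleTransversal-transversal c with cycleTransversal-cases c
      ... | inj₁ (s , _ , cs≡c , ρc≡fs) = trans (cong col ρc≡fs) cs≡c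
      ... | inj₂ (_ , ρc≡τc)            = trans (cong col ρc≡τc) (τ-transversal c)

      cycleTransversal-on-cycle : ∀ {s} → s < L → cycleTransversal (col (f s)) ≡ f s
      cycleTransversal-on-cycle {s} s<L with cycleTransversal-cases (col (f s))
      ... | inj₁ (s′ , s′<L , cs′≡cs , ρ≡fs′) = trans ρ≡fs′ (cong f (colour-injective s′<L s<L cs′≡cs))
      ... | inj₂ (∄s , _)                    = contradiction refl (∄s s s<L)

-- Rainbow circuits and monochromatic cuts

module RainbowCircuitOrMonochromaticCut {n m} (M : Matroid n) (A : Fin n → Fin m → Bool) (rep : Represents M A)
  {B₀} (basis₀ : Basis M B₀) (col : Fin n → Fin ∣ B₀ ∣) (surjective : SurjectiveColoring col) (x₀ : Fin n) where

  open BinaryMatroid M A rep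
  open Colouring col surjective

  Outcome : Set
  Outcome = (∃ λ C → Circuit M C × Rainbow col C) ⊎ (∃ λ D → Cut M D × Monochromatic col D)

  dependent-transversal : ∀ {ρ} → IsTransversal ρ → ¬ Indep M (image ρ) → Outcome
  dependent-transversal transversal dependent =
    let C , C⊆ , circuit = circuit-⊆ _ dependent
    in inj₁ (C , circuit , rainbow-⊆ C⊆ (rainbow-transversal transversal))

  zeroSum-in-transversal : ∀ {ρ} → IsTransversal ρ → ∀ {Y e} → Y ⊆ image ρ → ZeroSum A Y → e ∈ Y → Outcome
  zeroSum-in-transversal transversal Y⊆ ΣY e∈Y = dependent-transversal transversal (zeroSum⇒dependent Y⊆ ΣY e∈Y)

  T : Subset n
  T = image τ

  module _ (T-indep : Indep M T) where

    open FundamentalCircuits T-indep (full-card-insert-dependent basis₀ (∣transversal∣ τ-transversal))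

    R : Fin ∣ B₀ ∣ → Fin n → Bool
    R c x = lookup (K x) (τ c)

    open FundamentalMatrix R

    ∈K⇒≡∨chosen : ∀ {x z} → z ∈ K x → z ≡ x ⊎ τ (col z) ≡ z
    ∈K⇒≡∨chosen = Data.Sum.map₂ (∈transversal⁻ τ-transversal) ∘ K-⊆

    K-∋-unchosen : ∀ {x} → Unchosen x → x ∈ K x
    K-∋-unchosen = K-∋ ∘ unchosen⇒∉

    swap-case : ∀ {x} → Unchosen x → R (col x) x ≡ false → Outcome
    swap-case {x} unchosen τ[cx]∉Kx =
      zeroSum-in-transversal (swapIn-transversal x τ-transversal) Kx⊆ (K-zeroSum x) (K-∋-unchosen unchosen)
      where
      Kx⊆ : K x ⊆ image (swapIn x τ)
      Kx⊆ {z} z∈ with ∈K⇒≡∨chosen {x} z∈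
      ... | inj₁ refl = ∈transversal (swapIn x τ) (swapIn-here x τ)
      ... | inj₂ τ[cz]≡z with col z ≟ col x
      ...   | yes cz≡cx = contradiction (subst (_∈ K x) (trans (sym τ[cz]≡z) (cong τ cz≡cx)) z∈) (lookup⇒∉ τ[cx]∉Kx)
      ...   | no  cz≢cx = ∈transversal (swapIn x τ) (trans (swapIn-there x τ cz≢cx) τ[cz]≡z)

    -- A basis avoiding colour c would extend T - τ c by an element e whose fundamental circuit avoids τ c.
    source-meetsEveryBasis : ∀ {c} → Source c → MeetsEveryBasis M (colourClass c)
    source-meetsEveryBasis {c} source B basis =
      decidable-stable (FP.any? (λ e → e SP.∈? colourClass c ×-dec e SP.∈? B)) λ disjoint →
        no-basis-avoids (λ {e} e∈B ce≡c → disjoint (e , ∈colourClass⁺ ce≡c , e∈B))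
      where
      ∣T-τc∣<∣B∣ : ∣ T - τ c ∣ < ∣ B ∣
      ∣T-τc∣<∣B∣ = ℕP.<-≤-trans (SP.x∈p⇒∣p-x∣<∣p∣ (∈-image τ c))
                     (ℕP.≤-reflexive (trans (∣transversal∣ τ-transversal) (sym (basis-card basis₀ basis))))
      no-basis-avoids : ¬ (∀ {e} → e ∈ B → col e ≢ c)
      no-basis-avoids avoids
        with e , e∈B , e∉T′ , T′+e-indep ←
               indep-aug M (indep-⊆ M (SP.p─q⊆p T ⁅ τ c ⁆) T-indep) (proj₁ basis) ∣T-τc∣<∣B∣ =
        zeroSum⇒dependent Ke⊆ (K-zeroSum e) (K-∋-unchosen unchosen) T′+e-indep
        where
        unchosen : Unchosen e
        unchosen τ[ce]≡e = e∉T′ (SP.x∈p∧x≢y⇒x∈p-y (∈transversal τ τ[ce]≡e)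
                                  (λ e≡τc → avoids e∈B (trans (cong col e≡τc) (τ-transversal c))))
        Ke⊆ : K e ⊆ ⁅ e ⁆ ∪ (T - τ c)
        Ke⊆ {z} z∈ with K-⊆ {e} z∈
        ... | inj₁ refl = SP.x∈p∪q⁺ (inj₁ (SP.x∈⁅x⁆ z))
        ... | inj₂ z∈T  = SP.x∈p∪q⁺ (inj₂ (SP.x∈p∧x≢y⇒x∈p-y z∈T
                            (λ z≡τc → lookup⇒∉ (source e unchosen (avoids e∈B)) (subst (_∈ K e) z≡τc z∈))))

    source-case : ∀ {c} → Source c → Outcome
    source-case {c} source =
      let D , D⊆ , cut = cut-⊆ (colourClass c) (source-meetsEveryBasis source)
      in inj₂ (D , cut , monochromatic-⊆ D⊆ (monochromatic-colourClass c))

    cycle-case : DiagonalOnes → (w : ClosedWalk) → Chordless w → Outcome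
    cycle-case diagonal w chordless = zeroSum-in-transversal cycleTransversal-transversal W⊆ ΣW f0∈W
      where
      open ClosedWalk w
      open ChordlessCycle diagonal w chordless

      W : Subset n
      W = ⨁ L (K ∘ f)

      ΣW : ZeroSum A W
      ΣW = zeroSum-⨁ A L (K ∘ f) (λ s _ → K-zeroSum (f s))

      f0∈W : f 0 ∈ W
      f0∈W = lookup⇒∈ (trans (lookup-⨁ L (K ∘ f) (f 0))
                         (xorSum-uniqueTrue L L≥1 (∈⇒lookup (K-∋-unchosen (good 0 L≥1))) only-K[f0]))
        where
        only-K[f0] : ∀ s → s < L → lookup (K (f s)) (f 0) ≡ true → s ≡ 0
        only-K[f0] s s<L f0∈Kfs with ∈K⇒≡∨chosen {f s} (lookup⇒∈ f0∈Kfs)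
        ... | inj₁ f0≡fs  = colour-injective s<L L≥1 (cong col (sym f0≡fs))
        ... | inj₂ chosen = contradiction chosen (good 0 L≥1)

      W⊆ : W ⊆ image cycleTransversal
      W⊆ {z} z∈W with s , s<L , z∈Kfs ← xorSum-true⇒∃ L (trans (sym (lookup-⨁ L (K ∘ f) z)) (∈⇒lookup z∈W))
        with ∈K⇒≡∨chosen {f s} (lookup⇒∈ z∈Kfs)
      ... | inj₁ refl = ∈transversal cycleTransversal (cycleTransversal-on-cycle s<L)
      ... | inj₂ τ[cz]≡z with cycleTransversal-cases (col z)
      ...   | inj₁ (s′ , s′<L , cs′≡cz , _) =
        contradiction (subst (_∈ W) (sym (trans (cong τ cs′≡cz) τ[cz]≡z)) z∈W)
                      (lookup⇒∉ (trans (lookup-⨁ L (K ∘ f) _) (row-parity s′<L)))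
      ...   | inj₂ (_ , ρ[cz]≡τ[cz]) = ∈transversal cycleTransversal (trans ρ[cz]≡τ[cz] τ[cz]≡z)

    outcome-independent : Outcome
    outcome-independent with trichotomy x₀
    ... | inj₁ (x , unchosen , Rxx≡false)       = swap-case unchosen Rxx≡false
    ... | inj₂ (inj₁ (c , source))              = source-case source
    ... | inj₂ (inj₂ (diagonal , w , chordless)) = cycle-case diagonal w chordless

  outcome : Outcome
  outcome with indep? T
  ... | no  dependent = dependent-transversal τ-transversal dependent
  ... | yes indep     = outcome-independent indep

-- Rainbow cuts and monochromatic circuits

module RainbowCutOrMonochromaticCircuit {n m} (M : Matroid n) (A : Fin n → Fin m → Bool) (rep : Represents M A)
  {B₀} (basis₀ : Basis M B₀) (col : Fin n → Fin (n ∸ ∣ B₀ ∣)) (surjective : SurjectiveColoring col) (x₀ : Fin n) where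

  open BinaryMatroid M A rep
  open Colouring col surjective

  Outcome : Set
  Outcome = (∃ λ D → Cut M D × Rainbow col D) ⊎ (∃ λ C → Circuit M C × Monochromatic col C)

  ∣∁transversal∣ : ∀ {ρ} → IsTransversal ρ → ∣ ∁ (image ρ) ∣ ≡ ∣ B₀ ∣
  ∣∁transversal∣ {ρ} transversal = begin
    ∣ ∁ (image ρ) ∣         ≡⟨ SP.∣∁p∣≡n∸∣p∣ (image ρ) ⟩
    n ∸ ∣ image ρ ∣         ≡⟨ cong (n ∸_) (∣transversal∣ transversal) ⟩
    n ∸ (n ∸ ∣ B₀ ∣)        ≡⟨ ℕP.m∸[m∸n]≡n (SP.∣p∣≤n B₀) ⟩
    ∣ B₀ ∣                  ∎
    where open ≡-Reasoning

  dependent-cotransversal : ∀ {ρ} → IsTransversal ρ → ¬ Indep M (∁ (image ρ)) → Outcome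
  dependent-cotransversal transversal dependent =
    let D , D⊆ , cut = cut-⊆ _ (∁-dependent⇒meetsEveryBasis basis₀
                                  (ℕP.≤-reflexive (∣∁transversal∣ transversal)) dependent)
    in inj₁ (D , cut , rainbow-⊆ D⊆ (rainbow-transversal transversal))

  zeroSum-in-cotransversal : ∀ {ρ} → IsTransversal ρ → ∀ {Y e} → Y ⊆ ∁ (image ρ) → ZeroSum A Y → e ∈ Y → Outcome
  zeroSum-in-cotransversal transversal Y⊆ ΣY e∈Y = dependent-cotransversal transversal (zeroSum⇒dependent Y⊆ ΣY e∈Y)

  I : Subset n
  I = ∁ (image τ)

  module _ (I-indep : Indep M I) where

    open FundamentalCircuits I-indep (full-card-insert-dependent basis₀ (∣∁transversal∣ τ-transversal))

    R : Fin (n ∸ ∣ B₀ ∣) → Fin n → Bool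
    R c x = lookup (K (τ c)) x

    open FundamentalMatrix R

    ∈Kτ⇒≡∨unchosen : ∀ {c z} → z ∈ K (τ c) → z ≡ τ c ⊎ Unchosen z
    ∈Kτ⇒≡∨unchosen {c} = Data.Sum.map₂ (∉⇒unchosen ∘ SP.x∈∁p⇒x∉p) ∘ K-⊆ {τ c}

    Kτ-∋ : ∀ c → τ c ∈ K (τ c)
    Kτ-∋ c = K-∋ (SP.x∈p⇒x∉∁p (∈-image τ c))

    swap-case : ∀ {x} → Unchosen x → R (col x) x ≡ false → Outcome
    swap-case {x} unchosen x∉K =
      zeroSum-in-cotransversal (swapIn-transversal x τ-transversal) K⊆ (K-zeroSum (τ (col x))) (Kτ-∋ (col x))
      where
      K⊆ : K (τ (col x)) ⊆ ∁ (image (swapIn x τ))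
      K⊆ {z} z∈ = ∉transversal (swapIn-transversal x τ-transversal) λ fixed → case swapIn-fixed x τ fixed of λ where
        (inj₁ z≡x)               → lookup⇒∉ x∉K (subst (_∈ K (τ (col x))) z≡x z∈)
        (inj₂ (cz≢cx , τ[cz]≡z)) → case ∈Kτ⇒≡∨unchosen {col x} z∈ of λ where
          (inj₁ z≡τ[cx])  → cz≢cx (trans (cong col z≡τ[cx]) (τ-transversal (col x)))
          (inj₂ unchosen) → unchosen τ[cz]≡z

    source-case : ∀ {c} → Source c → Outcome
    source-case {c} source =
      let C , C⊆ , circuit = circuit-⊆ (K (τ c)) (zeroSum⇒dependent id (K-zeroSum (τ c)) (Kτ-∋ c))
      in inj₂ (C , circuit , monochromatic-⊆ C⊆ λ x∈ y∈ → trans (K-colour x∈) (sym (K-colour y∈)))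
      where
      K-colour : ∀ {z} → z ∈ K (τ c) → col z ≡ c
      K-colour {z} z∈ with ∈Kτ⇒≡∨unchosen {c} z∈
      ... | inj₁ refl     = τ-transversal c
      ... | inj₂ unchosen = decidable-stable (col z ≟ c) λ cz≢c → lookup⇒∉ (source z unchosen cz≢c) z∈

    cycle-case : DiagonalOnes → (w : ClosedWalk) → Chordless w → Outcome
    cycle-case diagonal w chordless = zeroSum-in-cotransversal cycleTransversal-transversal W⊆ ΣW τ[cf0]∈W
      where
      open ClosedWalk w
      open ChordlessCycle diagonal w chordless

      Ks : ℕ → Subset n
      Ks s = K (τ (col (f s)))

      W : Subset n
      W = ⨁ L Ks

      ΣW : ZeroSum A W
      ΣW = zeroSum-⨁ A L Ks (λ s _ → K-zeroSum (τ (col (f s))))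

      τ[cf0]∈W : τ (col (f 0)) ∈ W
      τ[cf0]∈W = lookup⇒∈ (trans (lookup-⨁ L Ks _) (xorSum-uniqueTrue L L≥1 (∈⇒lookup (Kτ-∋ (col (f 0)))) only-Ks0))
        where
        only-Ks0 : ∀ s → s < L → lookup (Ks s) (τ (col (f 0))) ≡ true → s ≡ 0
        only-Ks0 s s<L τ[cf0]∈Ks with ∈Kτ⇒≡∨unchosen {col (f s)} (lookup⇒∈ τ[cf0]∈Ks)
        ... | inj₁ τ[cf0]≡τ[cfs] = colour-injective s<L L≥1 (sym (transversal-injective τ-transversal τ[cf0]≡τ[cfs]))
        ... | inj₂ unchosen      = contradiction unchosen (τ-chosen (col (f 0)))

      W⊆ : W ⊆ ∁ (image cycleTransversal)
      W⊆ {z} z∈W with s , s<L , z∈Ks ← xorSum-true⇒∃ L (trans (sym (lookup-⨁ L Ks z)) (∈⇒lookup z∈W))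
        with ∈Kτ⇒≡∨unchosen {col (f s)} (lookup⇒∈ z∈Ks)
      ... | inj₁ refl = ∉transversal cycleTransversal-transversal λ ρ≡τ →
        good s s<L (sym (trans (sym (cycleTransversal-on-cycle s<L))
                               (trans (cong cycleTransversal (sym (τ-transversal (col (f s))))) ρ≡τ)))
      ... | inj₂ unchosen with cycleTransversal-cases (col z)
      ...   | inj₁ (s′ , s′<L , _ , ρ[cz]≡fs′) = ∉transversal cycleTransversal-transversal λ ρ[cz]≡z →
        lookup⇒∉ (trans (lookup-⨁ L Ks _) (column-parity s′<L)) (subst (_∈ W) (trans (sym ρ[cz]≡z) ρ[cz]≡fs′) z∈W)
      ...   | inj₂ (_ , ρ[cz]≡τ[cz])        = ∉transversal cycleTransversal-transversal λ ρ[cz]≡z →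
        unchosen (trans (sym ρ[cz]≡τ[cz]) ρ[cz]≡z)

    outcome-independent : Outcome
    outcome-independent with trichotomy x₀
    ... | inj₁ (x , unchosen , Rxx≡false)       = swap-case unchosen Rxx≡false
    ... | inj₂ (inj₁ (c , source))              = source-case source
    ... | inj₂ (inj₂ (diagonal , w , chordless)) = cycle-case diagonal w chordless

  outcome : Outcome
  outcome with indep? I
  ... | no  dependent = dependent-cotransversal τ-transversal dependent
  ... | yes indep     = outcome-independent indep

theorem1 : ∀ {n : ℕ} (M : Matroid n) → IsBinary M → 1 ≤ n → (r : ℕ) → HasRank M r →
    ((c : Fin n → Fin r) → SurjectiveColoring c →
        (∃ λ C → Circuit M C × Rainbow c C) ⊎ (∃ λ D → Cut M D × Monochromatic c D))
    × ((c : Fin n → Fin (n ∸ r)) → SurjectiveColoring c →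
        (∃ λ D → Cut M D × Rainbow c D) ⊎ (∃ λ C → Circuit M C × Monochromatic c C))
theorem1 M (_ , A , represents) 1≤n r (B₀ , basis₀ , refl) =
  (λ c surjective → RainbowCircuitOrMonochromaticCut.outcome M A represents basis₀ c surjective x₀) ,
  (λ c surjective → RainbowCutOrMonochromaticCircuit.outcome M A represents basis₀ c surjective x₀)
  where x₀ = fromℕ< 1≤n
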